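{- For any complete theory $T$ the following conditions are equivalent: (1) $T$ is approximable; (2) $T$ is $\overline{\mathcal{T}}\setminus\{T\}$-approximated; (3) $T$ is not finitely axiomatizable.
   Context: $\overline{\mathcal{T}}$ is the class of all complete first-order theories of relational languages. For a class $\mathcal{T}$ and a theory $T\notin\mathcal{T}$, $T$ is $\mathcal{T}$-approximated (or $\mathcal{T}$-approximable) if for every sentence $\varphi\in T$ there is $T'\in\mathcal{T}$ with $\varphi\in T'$. $T$ is approximable if it is $\mathcal{T}$-approximable for some class $\mathcal{T}$. $T$ is finitely axiomatizable if there is a sentence $\varphi\in T$ which forces $T$ (i.e., $T$ is exactly the set of consequences of $\varphi$ in the language $\Sigma(T)$); in particular finitely axiomatizable theories have finite languages. -}

module Defs where

open import Level using (Level; 0ℓ; Setω) renaming (suc to lsuc)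
open import Data.Nat using (ℕ; zero; suc)
open import Data.Fin using (Fin; zero; suc)
open import Data.Product using (Σ; ∃; _×_; _,_)
open import Data.Empty using (⊥)
open import Data.Sum using (_⊎_)
open import Relation.Nullary using (¬_)
open import Relation.Binary.PropositionalEquality using (_≡_)
open import Function.Bundles using (_⇔_)

record Language : Set₁ where
  field
    Sym   : Set
    arity : Sym → ℕ
open Language public

-- Formulas with n free variables (de Bruijn); terms are variables only,
-- since the language is relational.

data Formula (L : Language) : ℕ → Set where
  rel   : ∀ {n} (R : Sym L) → (Fin (arity L R) → Fin n) → Formula L n
  _≐_   : ∀ {n} → Fin n → Fin n → Formula L n
  ⊥̇     : ∀ {n} → Formula L n
  ¬̇_    : ∀ {n} → Formula L n → Formula L n
  _∧̇_   : ∀ {n} → Formula L n → Formula L n → Formula L n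
  _∨̇_   : ∀ {n} → Formula L n → Formula L n → Formula L n
  _⇒̇_   : ∀ {n} → Formula L n → Formula L n → Formula L n
  ∀̇_    : ∀ {n} → Formula L (suc n) → Formula L n
  ∃̇_    : ∀ {n} → Formula L (suc n) → Formula L n

Sentence : Language → Set
Sentence L = Formula L 0

record Structure (L : Language) : Set₁ where
  field
    Carrier : Set
    point   : Carrier                 -- domains are nonempty
    relᴹ    : (R : Sym L) → (Fin (arity L R) → Carrier) → Set
open Structure public

extend : ∀ {A : Set} {n} → A → (Fin n → A) → Fin (suc n) → A
extend a ρ zero    = a
extend a ρ (suc i) = ρ i

Sat : ∀ {L n} (M : Structure L) → (Fin n → Carrier M) → Formula L n → Set
Sat M ρ (rel R xs) = relᴹ M R (λ i → ρ (xs i))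
Sat M ρ (x ≐ y)    = ρ x ≡ ρ y
Sat M ρ ⊥̇          = ⊥
Sat M ρ (¬̇ φ)      = ¬ Sat M ρ φ
Sat M ρ (φ ∧̇ ψ)    = Sat M ρ φ × Sat M ρ ψ
Sat M ρ (φ ∨̇ ψ)    = Sat M ρ φ ⊎ Sat M ρ ψ
Sat M ρ (φ ⇒̇ ψ)    = Sat M ρ φ → Sat M ρ ψ
Sat M ρ (∀̇ φ)      = (a : Carrier M) → Sat M (extend a ρ) φ
Sat M ρ (∃̇ φ)      = Σ (Carrier M) λ a → Sat M (extend a ρ) φ

_⊨_ : ∀ {L} → Structure L → Sentence L → Set
M ⊨ φ = Sat M (λ ()) φ

Theory : Language → Set₁
Theory L = Sentence L → Set

_≃ᵀ_ : ∀ {L} → Theory L → Theory L → Set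
T ≃ᵀ T′ = ∀ φ → T φ ⇔ T′ φ

Th : ∀ {L} → Structure L → Theory L
Th M φ = M ⊨ φ

IsComplete : ∀ {L} → Theory L → Set₁
IsComplete {L} T = Σ (Structure L) λ M → T ≃ᵀ Th M

Class : Language → Set₂
Class L = Theory L → Set₁

_∈ᶜ_ : ∀ {L} → Theory L → Class L → Set₁
T ∈ᶜ 𝒯 = Σ _ λ T′ → 𝒯 T′ × (T′ ≃ᵀ T)

AllCompleteExcept : ∀ {L} → Theory L → Class L
AllCompleteExcept T T′ = IsComplete T′ × ¬ (T′ ≃ᵀ T)

Approximated : ∀ {L} → Class L → Theory L → Set₁
Approximated 𝒯 T =
  ¬ (T ∈ᶜ 𝒯) × (∀ φ → T φ → Σ _ λ T′ → 𝒯 T′ × T′ φ)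

Approximable : ∀ {L} → Theory L → Set₂
Approximable {L} T =
  Σ (Class L) λ 𝒯 → (∀ T′ → 𝒯 T′ → IsComplete T′) × Approximated 𝒯 T

Forces : ∀ {L} → Sentence L → Theory L → Set₁
Forces {L} φ T = ∀ ψ → T ψ ⇔ ((M : Structure L) → M ⊨ φ → M ⊨ ψ)

FinitelyAxiomatizable : ∀ {L} → Theory L → Set₁
FinitelyAxiomatizable T = Σ _ λ φ → T φ × Forces φ T

Classical : Setω
Classical = ∀ {ℓ} {P : Set ℓ} → P ⊎ ¬ P

module Submission where

-- The key notion is forcing: a sentence φ forces the complete
-- theory T = Th(M) exactly when every model of φ has theory T (the forward
-- direction uses excluded middle: T contains each sentence or its negation,
-- and φ forces the one in T).  With this characterisation:
--   (1) ⇒ (2): every witness from an approximating class of complete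
--       theories is a complete theory different from T, since T itself is
--       not in the class;  (2) ⇒ (1) takes the class 𝒯̄ ∖ {T} itself.
--   (2) ⇒ (3): if φ ∈ T forced T, an approximating T′ = Th(M′) ∋ φ would
--       have M′ ⊨ φ, hence T′ = T, contradicting T′ ≠ T.
--   (3) ⇒ (2): no φ ∈ T forces T, so some model N of φ has Th(N) ≠ T, and
--       Th(N) ∈ 𝒯̄ ∖ {T} contains φ.

open import Defs
open import Data.Product using (Σ; _×_; _,_)
open import Data.Sum using (_⊎_; inj₁; inj₂)
open import Data.Empty using (⊥-elim)
open import Function.Base using (id; _∘_)
open import Function.Bundles using (_⇔_; mk⇔; Equivalence)
open import Relation.Nullary using (¬_)

open Equivalence using (to; from)

dne : Classical → ∀ {ℓ} {P : Set ℓ} → ¬ ¬ P → P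
dne lem {P = P} ¬¬p with lem {P = P}
... | inj₁ p  = p
... | inj₂ ¬p = ⊥-elim (¬¬p ¬p)

≃ᵀ-trans : ∀ {L} {T T′ T″ : Theory L} → T ≃ᵀ T′ → T′ ≃ᵀ T″ → T ≃ᵀ T″
≃ᵀ-trans e e′ φ = mk⇔ (to (e′ φ) ∘ to (e φ)) (from (e φ) ∘ from (e′ φ))

Th-complete : ∀ {L} (N : Structure L) → IsComplete (Th N)
Th-complete N = N , λ _ → mk⇔ id id

complete-decides : Classical → ∀ {L} {T : Theory L} → IsComplete T →
  ∀ ψ → T ψ ⊎ T (¬̇ ψ)
complete-decides lem (M , T≃ThM) ψ with lem {P = M ⊨ ψ}
... | inj₁ Mψ  = inj₁ (from (T≃ThM ψ) Mψ)
... | inj₂ ¬Mψ = inj₂ (from (T≃ThM (¬̇ ψ)) ¬Mψ)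

-- A sentence φ forces a complete theory T iff every model of φ has theory T.
-- Forward direction: a sentence true in a model of φ cannot have its
-- negation in T, so it lies in T by completeness.
forcing⇒models-have-theory : Classical → ∀ {L} {T : Theory L} {φ} →
  IsComplete T → Forces φ T → ∀ N → N ⊨ φ → Th N ≃ᵀ T
forcing⇒models-have-theory lem {T = T} cT φ-forces N Nφ ψ =
  mk⇔ NψT (λ Tψ → to (φ-forces ψ) Tψ N Nφ)
  where
  NψT : N ⊨ ψ → T ψ
  NψT Nψ with complete-decides lem cT ψ
  ... | inj₁ Tψ  = Tψ
  ... | inj₂ T¬ψ = ⊥-elim (to (φ-forces (¬̇ ψ)) T¬ψ N Nφ Nψ)

-- Backward direction: the consequences of φ hold in the model M of T
-- (which satisfies φ ∈ T), hence lie in T.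
models-have-theory⇒forcing : ∀ {L} {T : Theory L} {φ} →
  IsComplete T → T φ → (∀ N → N ⊨ φ → Th N ≃ᵀ T) → Forces φ T
models-have-theory⇒forcing {φ = φ} (M , T≃ThM) Tφ pinned ψ =
  mk⇔ (λ Tψ N Nφ → from (pinned N Nφ ψ) Tψ)
      (λ φ⊨ψ → from (T≃ThM ψ) (φ⊨ψ M (to (T≃ThM φ) Tφ)))

non-forcing-countermodel : Classical → ∀ {L} {T : Theory L} {φ} →
  IsComplete T → T φ → ¬ Forces φ T →
  Σ (Structure L) λ N → N ⊨ φ × ¬ (Th N ≃ᵀ T)
non-forcing-countermodel lem cT Tφ ¬forces =
  dne lem λ no-countermodel → ¬forces
    (models-have-theory⇒forcing cT Tφ λ N Nφ →
      dne lem λ Th≄T → no-countermodel (N , Nφ , Th≄T))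

not-in-complement : ∀ {L} (T : Theory L) → ¬ (T ∈ᶜ AllCompleteExcept T)
not-in-complement T (T′ , (_ , T′≄T) , T′≃T) = T′≄T T′≃T

approximable⇒approximated-by-complement : ∀ {L} {T : Theory L} →
  Approximable T → Approximated (AllCompleteExcept T) T
approximable⇒approximated-by-complement {T = T} (𝒯 , 𝒯-complete , T∉𝒯 , approx) =
  not-in-complement T , witness
  where
  witness : ∀ φ → T φ → Σ _ λ T′ → AllCompleteExcept T T′ × T′ φ
  witness φ Tφ with approx φ Tφ
  ... | T′ , T′∈𝒯 , T′φ =
    T′ , (𝒯-complete T′ T′∈𝒯 , λ T′≃T → T∉𝒯 (T′ , T′∈𝒯 , T′≃T)) , T′φ

approximated-by-complement⇒approximable : ∀ {L} {T : Theory L} →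
  Approximated (AllCompleteExcept T) T → Approximable T
approximated-by-complement⇒approximable {T = T} approx =
  AllCompleteExcept T , (λ _ (complete , _) → complete) , approx

-- (2) ⇒ (3): an approximating theory containing a forcing sentence equals T.
approximated-by-complement⇒not-finitely-axiomatizable : Classical →
  ∀ {L} {T : Theory L} → IsComplete T →
  Approximated (AllCompleteExcept T) T → ¬ FinitelyAxiomatizable T
approximated-by-complement⇒not-finitely-axiomatizable lem {T = T} cT
  (_ , approx) (φ , Tφ , φ-forces) with approx φ Tφ
... | T′ , ((M′ , T′≃ThM′) , T′≄T) , T′φ =
  T′≄T (≃ᵀ-trans T′≃ThM′ ThM′≃T)
  where
  ThM′≃T : Th M′ ≃ᵀ T
  ThM′≃T = forcing⇒models-have-theory lem {φ = φ} cT φ-forces M′ (to (T′≃ThM′ φ) T′φ)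

-- (3) ⇒ (2): a countermodel to φ forcing T supplies the witness Th(N).
not-finitely-axiomatizable⇒approximated-by-complement : Classical →
  ∀ {L} {T : Theory L} → IsComplete T →
  ¬ FinitelyAxiomatizable T → Approximated (AllCompleteExcept T) T
not-finitely-axiomatizable⇒approximated-by-complement lem {T = T} cT ¬fa =
  not-in-complement T , witness
  where
  witness : ∀ φ → T φ → Σ _ λ T′ → AllCompleteExcept T T′ × T′ φ
  witness φ Tφ with non-forcing-countermodel lem cT Tφ (λ forces → ¬fa (φ , Tφ , forces))
  ... | N , Nφ , ThN≄T = Th N , (Th-complete N , ThN≄T) , Nφ

proposition3p1 : Classical → (L : Language) (T : Theory L) → IsComplete T →
    (Approximable T ⇔ Approximated (AllCompleteExcept T) T)
    × (Approximated (AllCompleteExcept T) T ⇔ (¬ FinitelyAxiomatizable T))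
proposition3p1 lem L T cT =
  mk⇔ approximable⇒approximated-by-complement
      approximated-by-complement⇒approximable ,
  mk⇔ (approximated-by-complement⇒not-finitely-axiomatizable lem cT)
      (not-finitely-axiomatizable⇒approximated-by-complement lem cT)
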